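{- Let $n\ge 3$. There exists a universal cycle (U-cycle) of the set of almost onto $n$-letter words on $[n]=\{1,\dots,n\}$.
   Context: A $k$-letter word on $[n]$ is a function $f:\{1,\dots,k\}\to\{1,\dots,n\}$, written as the string $f(1)f(2)\cdots f(k)$. Such a word is called almost onto if $|[n]\setminus \mathrm{Range}(f)|=1$, i.e. exactly one letter of $[n]$ does not occur in it. Given a finite nonempty set $W$ of words of length $m$ over an alphabet, a U-cycle for $W$ is a cyclic sequence $x_0x_1\cdots x_{N-1}$ with $N=|W|$ such that the $N$ windows $x_ix_{i+1}\cdots x_{i+m-1}$ (indices taken modulo $N$), $i=0,\dots,N-1$, are exactly the elements of $W$, each occurring exactly once. -}

module Defs where

open import Data.Nat using (ℕ; zero; suc; _+_; NonZero)
open import Data.Nat.DivMod using (_%_; m%n<n)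
open import Data.Fin using (Fin; toℕ; fromℕ<)
open import Data.Vec using (Vec; tabulate)
open import Data.Vec.Membership.Propositional using (_∈_; _∉_)
open import Data.Product using (Σ; _×_; ∃)
open import Relation.Binary.PropositionalEquality using (_≡_; _≢_)
open import Relation.Nullary using (¬_)

-- A k-letter word on [n] = {0,…,n-1} (Fin n), written f(1)…f(k) as a vector.
Word : ℕ → ℕ → Set
Word n k = Vec (Fin n) k

AlmostOnto : {n k : ℕ} → Word n k → Set
AlmostOnto {n} w = Σ (Fin n) λ a → (a ∉ w) × (∀ (b : Fin n) → b ≢ a → b ∈ w)

_+mod_ : {N : ℕ} .{{_ : NonZero N}} → Fin N → ℕ → Fin N
_+mod_ {N} i j = fromℕ< (m%n<n (toℕ i + j) N)

window : {A : Set} {N : ℕ} .{{_ : NonZero N}} → (m : ℕ) → (Fin N → A) → Fin N → Vec A m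
window m x i = tabulate λ j → x (i +mod toℕ j)

-- x : Fin N → A is a U-cycle for the set W ⊆ A^m (given as a predicate) iff
-- N ≥ 1 and the N windows x_i…x_{i+m-1} (indices mod N) are exactly the
-- elements of W, each occurring exactly once:
--  * every window lies in W,
--  * distinct positions give distinct windows,
--  * every element of W occurs as some window.
-- (Then N = |W| automatically, since i ↦ window i is a bijection Fin N ≅ W.)
record IsUCycle {A : Set} (m : ℕ) (W : Vec A m → Set) {N : ℕ} .{{_ : NonZero N}}
                (x : Fin N → A) : Set where
  field
    windows-in-W : ∀ (i : Fin N) → W (window m x i)
    windows-distinct : ∀ (i j : Fin N) → window m x i ≡ window m x j → i ≡ j
    covers-W : ∀ (w : Vec A m) → W w → ∃ λ (i : Fin N) → window m x i ≡ w

HasUCycle : {A : Set} (m : ℕ) (W : Vec A m → Set) → Set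
HasUCycle {A} m W = Σ ℕ λ N → Σ (NonZero N) λ nz → Σ (Fin N → A) λ x → IsUCycle m W {{nz}} x

module Submission where

-- Cycle joining. Almost onto words are closed under rotation, and the rotations of a word form a closed
-- walk in the de Bruijn graph, where each word is followed by a word overlapping it in all but one letter.
-- Two words differing only in their first letter have the same successors, so exchanging their successors
-- merges the closed walks through them. Starting from the necklace of a base word, we repeatedly merge in
-- the necklace of an uncovered almost onto word sharing its tail with a covered one. Such a word exists
-- because, for n ≥ 3, every almost onto word is turned into the base word by changing one letter at a time
-- through almost onto words (make n - 1 the missing letter, then sort by transpositions, each realised by
-- two or three letter changes); rotating the step that enters the covered set brings its changed letter to
-- the front. The first letters of the final closed walk form the U-cycle.

open import Defs
open import Data.Bool using (true; false)
open import Data.Empty using (⊥; ⊥-elim)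
open import Data.Fin using (Fin; zero; suc; toℕ; fromℕ; fromℕ<; inject₁; lower₁; _≟_)
open import Data.Fin.Properties
  using (toℕ-injective; suc-injective; inject₁-injective; inject₁-lower₁; fromℕ≢inject₁;
         toℕ-fromℕ<; toℕ<n; toℕ-inject₁; toℕ-fromℕ; fromℕ<-toℕ)
  renaming (any? to anyᶠ?; all? to allᶠ?)
open import Data.List using (List; []; _∷_; _++_; length; applyUpTo; allFin; cartesianProductWith)
import Data.List as List
import Data.List.Membership.DecPropositional as DecMembership
open import Data.List.Membership.Propositional using (_∈_; _∉_; find; lose)
open import Data.List.Membership.Propositional.Properties
  using (∈-∃++; ∈-++⁻; ∈-++⁺ˡ; ∈-++⁺ʳ; ∈-lookup; ∈-applyUpTo⁺; ∈-applyUpTo⁻; ∈-allFin;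
         ∈-cartesianProductWith⁺)
open import Data.List.Relation.Binary.Disjoint.Propositional using (Disjoint)
open import Data.List.Relation.Binary.Permutation.Propositional
  using (_↭_; ↭-refl; ↭-prep; ↭-sym; ↭-trans; ↭⇒↭ₛ)
open import Data.List.Relation.Binary.Permutation.Propositional.Properties
  using (shift; ++-comm; ++⁺ʳ; ∈-resp-↭)
import Data.List.Relation.Binary.Permutation.Setoid.Properties as PermutationSetoid
open import Data.List.Relation.Binary.Subset.Propositional using (_⊆_)
import Data.List.Relation.Unary.All as All
open import Data.List.Relation.Unary.AllPairs using (_∷_)
open import Data.List.Relation.Unary.Any using (here; there; any?; index)
open import Data.List.Relation.Unary.Any.Properties using (lookup-index)
open import Data.List.Relation.Unary.Unique.Propositional using (Unique)
open import Data.List.Relation.Unary.Unique.Propositional.Properties using (applyUpTo⁺₁; ++⁺)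
open import Data.Nat using (ℕ; zero; suc; _+_; _*_; _≤_; _<_; _≥_; _%_; NonZero; s≤s; z≤n; s≤s⁻¹; _<?_)
open import Data.Nat.DivMod using (%-distribˡ-+; m%n%n≡m%n; [m+kn]%n≡m%n; m<n⇒m%n≡m; n%n≡0)
open import Data.Nat.Induction using (<-wellFounded)
open import Data.Nat.Properties
  using (+-assoc; +-comm; +-suc; +-identityʳ; *-suc; *-identityˡ; ≤-refl; ≤-antisym; ≮⇒≥; ≤-<-trans;
         <⇒≤; <⇒≢; ≤⇒≯; m≤n+m; m<n⇒m<1+n; m≤n⇒m≤1+n; m≤n⇒m<n∨m≡n; m≤n⇒∃[o]m+o≡n)
open import Data.Product using (Σ; ∃; _×_; _,_; proj₁; proj₂)
open import Data.Sum using (_⊎_; inj₁; inj₂; [_,_])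
open import Data.Vec using (Vec; tabulate; lookup; _[_]≔_; count)
import Data.Vec as Vec
import Data.Vec.Membership.DecPropositional as DecVecMembership
open import Data.Vec.Membership.Propositional using () renaming (_∈_ to _∈ᵥ_)
open import Data.Vec.Membership.Propositional.Properties using () renaming (∈-lookup to ∈-lookupᵥ)
open import Data.Vec.Properties using (lookup∘tabulate; lookup∘update; lookup∘update′; ≡-dec)
open import Data.Vec.Relation.Binary.Pointwise.Extensional using (ext; Pointwise-≡⇒≡)
import Data.Vec.Relation.Unary.Any as Anyᵥ
open import Data.Vec.Relation.Unary.Any.Properties using () renaming (lookup-index to lookup-indexᵥ)
open import Function using (_∘_)
open import Induction.WellFounded using (Acc; acc)
open import Relation.Binary.Construct.Closure.ReflexiveTransitive using (Star; ε; _◅_; _◅◅_)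
open import Relation.Binary.Definitions using (DecidableEquality)
open import Relation.Binary.PropositionalEquality
  using (_≡_; _≢_; refl; setoid; sym; trans; cong; subst; module ≡-Reasoning)
open import Relation.Nullary using (¬_; Dec; yes; no; does; ¬?; contradiction)
open import Relation.Nullary.Decidable using (_×-dec_; _→-dec_; decidable-stable; dec-true; dec-false)
open import Relation.Unary using (Decidable)

Vec-ext : ∀ {A : Set} {l} {xs ys : Vec A l} → (∀ i → lookup xs i ≡ lookup ys i) → xs ≡ ys
Vec-ext eq = Pointwise-≡⇒≡ (ext eq)

module _ {N : ℕ} .{{_ : NonZero N}} where
  open ≡-Reasoning

  toℕ-+mod : ∀ (i : Fin N) t → toℕ (i +mod t) ≡ (toℕ i + t) % N
  toℕ-+mod i t = toℕ-fromℕ< _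

  +mod-+mod : ∀ (i : Fin N) s t → (i +mod s) +mod t ≡ i +mod (s + t)
  +mod-+mod i s t = toℕ-injective (begin
    toℕ ((i +mod s) +mod t)           ≡⟨ toℕ-+mod (i +mod s) t ⟩
    (toℕ (i +mod s) + t) % N          ≡⟨ cong (λ x → (x + t) % N) (toℕ-+mod i s) ⟩
    ((toℕ i + s) % N + t) % N         ≡⟨ %-distribˡ-+ ((toℕ i + s) % N) t N ⟩
    ((toℕ i + s) % N % N + t % N) % N ≡⟨ cong (λ x → (x + t % N) % N) (m%n%n≡m%n (toℕ i + s) N) ⟩
    ((toℕ i + s) % N + t % N) % N     ≡⟨ %-distribˡ-+ (toℕ i + s) t N ⟨
    (toℕ i + s + t) % N               ≡⟨ cong (_% N) (+-assoc (toℕ i) s t) ⟩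
    (toℕ i + (s + t)) % N             ≡⟨ toℕ-+mod i (s + t) ⟨
    toℕ (i +mod (s + t))              ∎)

  +mod-multiple : ∀ (i : Fin N) q → i +mod (q * N) ≡ i
  +mod-multiple i q = toℕ-injective (begin
    toℕ (i +mod (q * N))   ≡⟨ toℕ-+mod i (q * N) ⟩
    (toℕ i + q * N) % N    ≡⟨ [m+kn]%n≡m%n (toℕ i) q N ⟩
    toℕ i % N              ≡⟨ m<n⇒m%n≡m (toℕ<n i) ⟩
    toℕ i                  ∎)

  rotate : ∀ {A : Set} → ℕ → Vec A N → Vec A N
  rotate t w = tabulate λ p → lookup w (p +mod t)

  lookup-rotate : ∀ {A : Set} t (w : Vec A N) p → lookup (rotate t w) p ≡ lookup w (p +mod t)
  lookup-rotate t w p = lookup∘tabulate _ p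

  rotate-rotate : ∀ {A : Set} s t (w : Vec A N) → rotate s (rotate t w) ≡ rotate (s + t) w
  rotate-rotate s t w = Vec-ext λ p → begin
    lookup (rotate s (rotate t w)) p ≡⟨ lookup-rotate s (rotate t w) p ⟩
    lookup (rotate t w) (p +mod s)   ≡⟨ lookup-rotate t w (p +mod s) ⟩
    lookup w ((p +mod s) +mod t)     ≡⟨ cong (lookup w) (+mod-+mod p s t) ⟩
    lookup w (p +mod (s + t))        ≡⟨ lookup-rotate (s + t) w p ⟨
    lookup (rotate (s + t) w) p      ∎

  rotate-multiple : ∀ {A : Set} q (w : Vec A N) → rotate (q * N) w ≡ w
  rotate-multiple q w = Vec-ext λ p → trans (lookup-rotate (q * N) w p) (cong (lookup w) (+mod-multiple p q))

  rotate-zero : ∀ {A : Set} (w : Vec A N) → rotate 0 w ≡ w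
  rotate-zero = rotate-multiple 0

inject₁-+mod-1 : ∀ {n} (j : Fin n) → inject₁ j +mod 1 ≡ suc j
inject₁-+mod-1 {n} j = toℕ-injective (begin
  toℕ (inject₁ j +mod 1)        ≡⟨ toℕ-+mod (inject₁ j) 1 ⟩
  (toℕ (inject₁ j) + 1) % suc n ≡⟨ cong (λ x → (x + 1) % suc n) (toℕ-inject₁ j) ⟩
  (toℕ j + 1) % suc n           ≡⟨ cong (_% suc n) (+-comm (toℕ j) 1) ⟩
  suc (toℕ j) % suc n           ≡⟨ m<n⇒m%n≡m (s≤s (toℕ<n j)) ⟩
  suc (toℕ j)                   ∎)
  where open ≡-Reasoning

fromℕ-+mod-1 : ∀ n → fromℕ n +mod 1 ≡ zero
fromℕ-+mod-1 n = toℕ-injective (begin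
  toℕ (fromℕ n +mod 1)        ≡⟨ toℕ-+mod (fromℕ n) 1 ⟩
  (toℕ (fromℕ n) + 1) % suc n ≡⟨ cong (λ x → (x + 1) % suc n) (toℕ-fromℕ n) ⟩
  (n + 1) % suc n             ≡⟨ cong (_% suc n) (+-comm n 1) ⟩
  suc n % suc n               ≡⟨ n%n≡0 (suc n) ⟩
  0                           ∎)
  where open ≡-Reasoning

fromℕ-or-inject₁ : ∀ {n} (i : Fin (suc n)) → i ≡ fromℕ n ⊎ Σ (Fin n) λ j → i ≡ inject₁ j
fromℕ-or-inject₁ {zero} zero = inj₁ refl
fromℕ-or-inject₁ {suc n} zero = inj₂ (zero , refl)
fromℕ-or-inject₁ {suc n} (suc i) with fromℕ-or-inject₁ i
... | inj₁ p = inj₁ (cong suc p)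
... | inj₂ (j , p) = inj₂ (suc j , cong suc p)

module Chains {A : Set} (R : A → A → Set) where

  data Chain : A → List A → A → Set where
    end : ∀ {a b} → R a b → Chain a [] b
    _∷_ : ∀ {a x xs b} → R a x → Chain x xs b → Chain a (x ∷ xs) b

  Closed : List A → Set
  Closed [] = ⊥
  Closed (x ∷ xs) = Chain x xs x

  Chain-++ : ∀ {a b c} xs {ys} → Chain a xs b → Chain b ys c → Chain a (xs ++ b ∷ ys) c
  Chain-++ [] (end r) q = r ∷ q
  Chain-++ (x ∷ xs) (r ∷ p) q = r ∷ Chain-++ xs p q

  Chain-split : ∀ {a b c} xs {ys} → Chain a (xs ++ b ∷ ys) c → Chain a xs b × Chain b ys c
  Chain-split [] (r ∷ q) = end r , q
  Chain-split (x ∷ xs) (r ∷ p) with Chain-split xs p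
  ... | p₁ , p₂ = r ∷ p₁ , p₂

  Chain-retarget : ∀ {a a' xs b} → (∀ {h} → R a h → R a' h) → Chain a xs b → Chain a' xs b
  Chain-retarget f (end r) = end (f r)
  Chain-retarget f (r ∷ p) = f r ∷ p

  Chain-applyUpTo : ∀ {f : ℕ → A} → (∀ t → R (f t) (f (suc t))) →
                    ∀ c → Chain (f 0) (applyUpTo (f ∘ suc) c) (f (suc c))
  Chain-applyUpTo step zero = end (step 0)
  Chain-applyUpTo step (suc c) = step 0 ∷ Chain-applyUpTo (step ∘ suc) c

  Closed-startAt : ∀ {x xs e} → Chain x xs x → e ∈ x ∷ xs →
                   Σ (List A) λ ys → Chain e ys e × (e ∷ ys) ↭ (x ∷ xs)
  Closed-startAt {xs = xs} p (here refl) = xs , p , ↭-refl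
  Closed-startAt {x} p (there e∈xs) with ∈-∃++ e∈xs
  ... | ys , zs , refl with Chain-split ys p
  ...   | p₁ , p₂ = zs ++ x ∷ ys , Chain-++ zs p₂ p₁ , ++-comm (_ ∷ zs) (x ∷ ys)

  Closed-join : ∀ {x xs y ys} → (∀ {h} → R x h → R y h) → (∀ {h} → R y h → R x h) →
                Chain x xs x → Chain y ys y → Chain x (ys ++ y ∷ xs) x
  Closed-join x⇒y y⇒x p q = Chain-++ _ (Chain-retarget y⇒x q) (Chain-retarget x⇒y p)

  Chain-lookup-inject₁ : ∀ {a xs b} → Chain a xs b → ∀ i →
                         R (List.lookup (a ∷ xs) (inject₁ i)) (List.lookup xs i)
  Chain-lookup-inject₁ (r ∷ p) zero = r
  Chain-lookup-inject₁ (r ∷ p) (suc i) = Chain-lookup-inject₁ p i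

  Chain-lookup-last : ∀ {a xs b} → Chain a xs b → R (List.lookup (a ∷ xs) (fromℕ (length xs))) b
  Chain-lookup-last (end r) = r
  Chain-lookup-last (r ∷ p) = Chain-lookup-last p

  Closed-lookup-next : ∀ {x xs} → Chain x xs x → ∀ i →
                       R (List.lookup (x ∷ xs) i) (List.lookup (x ∷ xs) (i +mod 1))
  Closed-lookup-next {x} {xs} p i with fromℕ-or-inject₁ i
  ... | inj₁ refl = subst (R (List.lookup (x ∷ xs) (fromℕ (length xs))) ∘ List.lookup (x ∷ xs))
                          (sym (fromℕ-+mod-1 (length xs))) (Chain-lookup-last p)
  ... | inj₂ (j , refl) = subst (R (List.lookup (x ∷ xs) (inject₁ j)) ∘ List.lookup (x ∷ xs))
                                (sym (inject₁-+mod-1 j)) (Chain-lookup-inject₁ p j)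

Unique-lookup-injective : ∀ {A : Set} {xs : List A} → Unique xs →
                          ∀ {i j} → List.lookup xs i ≡ List.lookup xs j → i ≡ j
Unique-lookup-injective (x∉ ∷ u) {zero} {zero} eq = refl
Unique-lookup-injective (x∉ ∷ u) {zero} {suc j} eq = ⊥-elim (All.lookup x∉ (∈-lookup j) eq)
Unique-lookup-injective (x∉ ∷ u) {suc i} {zero} eq = ⊥-elim (All.lookup x∉ (∈-lookup i) (sym eq))
Unique-lookup-injective (x∉ ∷ u) {suc i} {suc j} eq = cong suc (Unique-lookup-injective u eq)

data Move {A : Set} {N : ℕ} (S : Vec A N → Set) (w : Vec A N) : Vec A N → Set where
  change : ∀ j y → S (w [ j ]≔ y) → Move S w (w [ j ]≔ y)

module Words {k m : ℕ} where

  W : Set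
  W = Word k (suc m)

  _≟W_ : DecidableEquality W
  _≟W_ = ≡-dec _≟_

  open DecMembership _≟W_ using (_∈?_)

  Overlaps : W → W → Set
  Overlaps e f = ∀ (p : Fin m) → lookup e (suc p) ≡ lookup f (inject₁ p)

  SameTail : W → W → Set
  SameTail e e' = ∀ (p : Fin m) → lookup e (suc p) ≡ lookup e' (suc p)

  open Chains Overlaps using (Chain; Closed; Chain-applyUpTo)

  Overlaps-rotate : ∀ w → Overlaps w (rotate 1 w)
  Overlaps-rotate w p = sym (trans (lookup-rotate 1 w (inject₁ p)) (cong (lookup w) (inject₁-+mod-1 p)))

  +mod-inverse : ∀ (i : Fin (suc m)) t → (i +mod t) +mod (t * m) ≡ i
  +mod-inverse i t = begin
    (i +mod t) +mod (t * m) ≡⟨ +mod-+mod i t (t * m) ⟩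
    i +mod (t + t * m)      ≡⟨ cong (i +mod_) (*-suc t m) ⟨
    i +mod (t * suc m)      ≡⟨ +mod-multiple i t ⟩
    i                       ∎
    where open ≡-Reasoning

  +mod-injective : ∀ {i j : Fin (suc m)} t → i +mod t ≡ j +mod t → i ≡ j
  +mod-injective {i} {j} t eq = begin
    i                        ≡⟨ +mod-inverse i t ⟨
    (i +mod t) +mod (t * m)  ≡⟨ cong (_+mod (t * m)) eq ⟩
    (j +mod t) +mod (t * m)  ≡⟨ +mod-inverse j t ⟩
    j                        ∎
    where open ≡-Reasoning

  rotate-inverse : ∀ t (w : W) → rotate (t * m) (rotate t w) ≡ w
  rotate-inverse t w = begin
    rotate (t * m) (rotate t w) ≡⟨ rotate-rotate (t * m) t w ⟩
    rotate (t * m + t) w        ≡⟨ cong (λ s → rotate s w) (trans (+-comm (t * m) t) (sym (*-suc t m))) ⟩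
    rotate (t * suc m) w        ≡⟨ rotate-multiple t w ⟩
    w                           ∎
    where open ≡-Reasoning

  rotate-injective : ∀ t {v w : W} → rotate t v ≡ rotate t w → v ≡ w
  rotate-injective t {v} {w} eq =
    trans (sym (rotate-inverse t v)) (trans (cong (rotate (t * m)) eq) (rotate-inverse t w))

  rotate-closed : (P : W → Set) → (∀ {w} → P w → P (rotate 1 w)) → ∀ t {w} → P w → P (rotate t w)
  rotate-closed P P-rotate zero {w} pw = subst P (sym (rotate-zero w)) pw
  rotate-closed P P-rotate (suc t) {w} pw =
    subst P (rotate-rotate 1 t w) (P-rotate {rotate t w} (rotate-closed P P-rotate t pw))

  rotate-closed⁻ : (P : W → Set) → (∀ {w} → P w → P (rotate 1 w)) → ∀ t {w} → P (rotate t w) → P w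
  rotate-closed⁻ P P-rotate t {w} pw = subst P (rotate-inverse t w) (rotate-closed P P-rotate (t * m) pw)

  ∈-rotate⁻ : ∀ {b} t (w : W) → b ∈ᵥ rotate t w → b ∈ᵥ w
  ∈-rotate⁻ t w b∈ =
    subst (_∈ᵥ w) (sym (trans (lookup-indexᵥ b∈) (lookup-rotate t w i))) (∈-lookupᵥ (i +mod t) w)
    where i = Anyᵥ.index b∈

  ∈-rotate⁺ : ∀ {b} t (w : W) → b ∈ᵥ w → b ∈ᵥ rotate t w
  ∈-rotate⁺ t w b∈ = ∈-rotate⁻ (t * m) (rotate t w) (subst (_ ∈ᵥ_) (sym (rotate-inverse t w)) b∈)

  -- Rotation by j brings position j to the front, and translation being injective, nothing else comes from j.
  SameTail-rotate-update : ∀ (w : W) j y → SameTail (rotate (toℕ j) w) (rotate (toℕ j) (w [ j ]≔ y))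
  SameTail-rotate-update w j y p = begin
    lookup (rotate (toℕ j) w) (suc p)            ≡⟨ lookup-rotate (toℕ j) w (suc p) ⟩
    lookup w (suc p +mod toℕ j)                  ≡⟨ lookup∘update′ shifted≢j w y ⟨
    lookup (w [ j ]≔ y) (suc p +mod toℕ j)       ≡⟨ lookup-rotate (toℕ j) (w [ j ]≔ y) (suc p) ⟨
    lookup (rotate (toℕ j) (w [ j ]≔ y)) (suc p) ∎
    where
    open ≡-Reasoning
    zero+mod : zero +mod toℕ j ≡ j
    zero+mod = toℕ-injective (trans (toℕ-+mod zero (toℕ j)) (m<n⇒m%n≡m (toℕ<n j)))
    shifted≢j : suc p +mod toℕ j ≢ j
    shifted≢j eq with +mod-injective {suc p} {zero} (toℕ j) (trans eq (sym zero+mod))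
    ... | ()

  module _ {N : ℕ} .{{_ : NonZero N}} (c : Fin N → W)
           (overlaps : ∀ i → Overlaps (c i) (c (i +mod 1))) where

    lookup-overlapping : ∀ t (t<n : t < suc m) i →
                         lookup (c i) (fromℕ< t<n) ≡ lookup (c (i +mod t)) zero
    lookup-overlapping zero _ i = cong (λ j → lookup (c j) zero) (sym (+mod-multiple i 0))
    lookup-overlapping (suc t) (s≤s t<m) i = begin
      lookup (c i) (suc (fromℕ< t<m))                ≡⟨ overlaps i (fromℕ< t<m) ⟩
      lookup (c (i +mod 1)) (inject₁ (fromℕ< t<m))   ≡⟨ cong (lookup (c (i +mod 1))) inject₁-fromℕ< ⟩
      lookup (c (i +mod 1)) (fromℕ< t<1+m)           ≡⟨ lookup-overlapping t t<1+m (i +mod 1) ⟩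
      lookup (c ((i +mod 1) +mod t)) zero            ≡⟨ cong (λ j → lookup (c j) zero) (+mod-+mod i 1 t) ⟩
      lookup (c (i +mod suc t)) zero                 ∎
      where
      open ≡-Reasoning
      t<1+m : t < suc m
      t<1+m = m<n⇒m<1+n t<m
      inject₁-fromℕ< : inject₁ (fromℕ< t<m) ≡ fromℕ< t<1+m
      inject₁-fromℕ< =
        toℕ-injective (trans (toℕ-inject₁ _) (trans (toℕ-fromℕ< t<m) (sym (toℕ-fromℕ< t<1+m))))

    window-overlapping : ∀ i → window (suc m) (λ i → lookup (c i) zero) i ≡ c i
    window-overlapping i = Vec-ext λ j → begin
      lookup (window (suc m) (λ i → lookup (c i) zero) i) j
        ≡⟨ lookup∘tabulate (λ j → lookup (c (i +mod toℕ j)) zero) j ⟩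
      lookup (c (i +mod toℕ j)) zero
        ≡⟨ lookup-overlapping (toℕ j) (toℕ<n j) i ⟨
      lookup (c i) (fromℕ< (toℕ<n j))
        ≡⟨ cong (lookup (c i)) (fromℕ<-toℕ j (toℕ<n j)) ⟩
      lookup (c i) j
        ∎
      where open ≡-Reasoning

  -- The least period of e is suc c.
  IsLeastPeriod : W → ℕ → Set
  IsLeastPeriod e c = rotate (suc c) e ≡ e × (∀ t → t < c → rotate (suc t) e ≢ e)

  leastPeriod : ∀ e → ∃ (IsLeastPeriod e)
  leastPeriod e = search 0 m refl (λ _ ())
    where
    search : ∀ c f → c + f ≡ m → (∀ t → t < c → rotate (suc t) e ≢ e) → ∃ (IsLeastPeriod e)
    search c zero c+0≡m below = c , subst (λ s → rotate (suc s) e ≡ e) m≡c full-turn , below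
      where
      m≡c : m ≡ c
      m≡c = trans (sym c+0≡m) (+-identityʳ c)
      full-turn : rotate (suc m) e ≡ e
      full-turn = subst (λ s → rotate s e ≡ e) (*-identityˡ (suc m)) (rotate-multiple 1 e)
    search c (suc f) c+f≡m below with rotate (suc c) e ≟W e
    ... | yes period = c , period , below
    ... | no ¬period = search (suc c) f (trans (sym (+-suc c f)) c+f≡m) below′
      where
      below′ : ∀ t → t < suc c → rotate (suc t) e ≢ e
      below′ t t<1+c with m≤n⇒m<n∨m≡n (s≤s⁻¹ t<1+c)
      ... | inj₁ t<c = below t t<c
      ... | inj₂ refl = ¬period

  necklace : W → ℕ → List W
  necklace e c = applyUpTo (λ t → rotate t e) (suc c)

  ∈-necklace⁻ : ∀ {e c y} → y ∈ necklace e c → ∃ λ t → t < suc c × y ≡ rotate t e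
  ∈-necklace⁻ {e} = ∈-applyUpTo⁻ (λ t → rotate t e)

  ∈-necklace⁺ : ∀ {e c t} → t < suc c → rotate t e ∈ necklace e c
  ∈-necklace⁺ {e} = ∈-applyUpTo⁺ (λ t → rotate t e)

  ∈-necklace-self : ∀ {e} c → e ∈ necklace e c
  ∈-necklace-self {e} c = subst (_∈ necklace e c) (rotate-zero e) (∈-necklace⁺ {e} {c} {0} (s≤s z≤n))

  necklace-closed : ∀ {e c} → rotate (suc c) e ≡ e → Closed (necklace e c)
  necklace-closed {e} {c} period =
    subst (Chain (rotate 0 e) (applyUpTo (λ t → rotate (suc t) e) c)) (trans period (sym (rotate-zero e)))
          (Chain-applyUpTo {λ t → rotate t e} step c)
    where
    step : ∀ t → Overlaps (rotate t e) (rotate (suc t) e)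
    step t = subst (Overlaps (rotate t e)) (rotate-rotate 1 t e) (Overlaps-rotate (rotate t e))

  necklace-unique : ∀ {e c} → IsLeastPeriod e c → Unique (necklace e c)
  necklace-unique {e} {c} (_ , minimal) = applyUpTo⁺₁ (λ t → rotate t e) (suc c) distinct
    where
    distinct : ∀ {i j} → i < j → j < suc c → rotate i e ≢ rotate j e
    distinct {i} i<j j<1+c eq with m≤n⇒∃[o]m+o≡n i<j
    ... | o , refl = minimal o (≤-<-trans (m≤n+m o i) (s≤s⁻¹ j<1+c)) (rotate-injective i (begin
      rotate i (rotate (suc o) e) ≡⟨ rotate-rotate i (suc o) e ⟩
      rotate (i + suc o) e        ≡⟨ cong (λ s → rotate s e) (+-suc i o) ⟩
      rotate (suc i + o) e        ≡⟨ eq ⟨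
      rotate i e                  ∎))
      where open ≡-Reasoning

  necklace-rotate : ∀ {e c y} → rotate (suc c) e ≡ e → y ∈ necklace e c → rotate 1 y ∈ necklace e c
  necklace-rotate {e} {c} period y∈ with ∈-necklace⁻ {e} {c} y∈
  ... | t , t<1+c , y≡ rewrite y≡ with suc t <? suc c
  ...   | yes t+1<1+c = subst (_∈ necklace e c) (sym (rotate-rotate 1 t e))
                              (∈-necklace⁺ {e} {c} {suc t} t+1<1+c)
  ...   | no t+1≮1+c = subst (_∈ necklace e c) (sym (trans (rotate-rotate 1 t e) t+1-period))
                             (∈-necklace-self c)
    where
    t+1-period : rotate (suc t) e ≡ e
    t+1-period = subst (λ s → rotate s e ≡ e) (≤-antisym (≮⇒≥ t+1≮1+c) t<1+c) period

  allVec : ∀ l → List (Vec (Fin k) l)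
  allVec zero = Vec.[] ∷ []
  allVec (suc l) = cartesianProductWith Vec._∷_ (allFin k) (allVec l)

  ∈-allVec : ∀ {l} (v : Vec (Fin k) l) → v ∈ allVec l
  ∈-allVec Vec.[] = here refl
  ∈-allVec (x Vec.∷ v) = ∈-cartesianProductWith⁺ Vec._∷_ (∈-allFin x) (∈-allVec v)

  allWords : List W
  allWords = allVec (suc m)

  unseen : List W → List W → ℕ
  unseen L [] = 0
  unseen L (v ∷ vs) with v ∈? L
  ... | yes _ = unseen L vs
  ... | no _ = suc (unseen L vs)

  unseen-mono : ∀ {L L'} → L ⊆ L' → ∀ vs → unseen L' vs ≤ unseen L vs
  unseen-mono sub [] = z≤n
  unseen-mono {L} {L'} sub (v ∷ vs) with v ∈? L | v ∈? L'
  ... | yes v∈L | no v∉L' = contradiction (sub v∈L) v∉L'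
  ... | yes _ | yes _ = unseen-mono sub vs
  ... | no _ | yes _ = m≤n⇒m≤1+n (unseen-mono sub vs)
  ... | no _ | no _ = s≤s (unseen-mono sub vs)

  unseen-mono-< : ∀ {L L' e} → L ⊆ L' → e ∉ L → e ∈ L' →
                  ∀ {vs} → e ∈ vs → unseen L' vs < unseen L vs
  unseen-mono-< {L} {L'} sub e∉L e∈L' {v ∷ vs} (here refl) with v ∈? L | v ∈? L'
  ... | yes e∈L | _ = contradiction e∈L e∉L
  ... | no _ | no e∉L' = contradiction e∈L' e∉L'
  ... | no _ | yes _ = s≤s (unseen-mono sub vs)
  unseen-mono-< {L} {L'} sub e∉L e∈L' {v ∷ vs} (there e∈vs) with v ∈? L | v ∈? L'
  ... | yes v∈L | no v∉L' = contradiction (sub v∈L) v∉L'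
  ... | yes _ | yes _ = unseen-mono-< sub e∉L e∈L' e∈vs
  ... | no _ | yes _ = m<n⇒m<1+n (unseen-mono-< sub e∉L e∈L' e∈vs)
  ... | no _ | no _ = s≤s (unseen-mono-< sub e∉L e∈L' e∈vs)

module CycleJoining {k m : ℕ} (S : Word k (suc m) → Set) (S? : Decidable S)
                    (S-rotate : ∀ {w} → S w → S (rotate 1 w))
                    (base : Word k (suc m)) (S-base : S base)
                    (connected : ∀ {w} → S w → Star (Move S) w base) where

  open Words {k} {m}
  open Chains Overlaps
  open DecMembership _≟W_ using (_∈?_)

  record PartialCycle (L : List W) : Set where
    field
      closed : Closed L
      unique : Unique L
      sound : ∀ {w} → w ∈ L → S w
      rotation-closed : ∀ {w} → w ∈ L → rotate 1 w ∈ L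
      base∈ : base ∈ L
  open PartialCycle

  necklace-sound : ∀ {e c w} → S e → w ∈ necklace e c → S w
  necklace-sound {e} {c} se w∈ =
    let (t , _ , w≡) = ∈-necklace⁻ {e} {c} w∈ in subst S (sym w≡) (rotate-closed S S-rotate t se)

  initial : Σ (List W) PartialCycle
  initial with leastPeriod base
  ... | c , least@(period , _) = necklace base c , record
    { closed = necklace-closed period
    ; unique = necklace-unique least
    ; sound = necklace-sound S-base
    ; rotation-closed = necklace-rotate period
    ; base∈ = ∈-necklace-self c
    }

  -- The step of the path that enters L, rotated so that its changed letter comes first.
  boundary : ∀ {L w} → (∀ {v} → v ∈ L → rotate 1 v ∈ L) → base ∈ L → w ∉ L → S w →
             Star (Move S) w base →
             Σ W λ e → Σ W λ e' → S e × e ∉ L × e' ∈ L × SameTail e e'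
  boundary _ base∈L base∉L _ ε = contradiction base∈L base∉L
  boundary {L} {w} L-rotate base∈L w∉L sw (change j y sw' ◅ path) with (w [ j ]≔ y) ∈? L
  ... | no w'∉L = boundary L-rotate base∈L w'∉L sw' path
  ... | yes w'∈L = rotate (toℕ j) w , rotate (toℕ j) (w [ j ]≔ y) ,
                   rotate-closed S S-rotate (toℕ j) sw ,
                   w∉L ∘ rotate-closed⁻ (_∈ L) L-rotate (toℕ j) ,
                   rotate-closed (_∈ L) L-rotate (toℕ j) w'∈L ,
                   SameTail-rotate-update w j y

  -- The necklace of e is spliced in after e': the successors of e and e' are exchanged.
  join-necklace : ∀ {L e e' c} → PartialCycle L → S e → e ∉ L → e' ∈ L → SameTail e e' →
                  IsLeastPeriod e c → Σ (List W) λ L' → PartialCycle L' × L' ↭ L ++ necklace e c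
  join-necklace {[]} P = ⊥-elim (closed P)
  join-necklace {x ∷ xs} {e} {e'} {c} P se e∉L e'∈L same least@(period , _)
    with Closed-startAt (closed P) e'∈L
  ... | ys , chain , e'ys↭L = L' , record
    { closed = Closed-join (λ o p → trans (same′ p) (o p)) (λ o p → trans (sym (same′ p)) (o p))
                           chain (necklace-closed period)
    ; unique = PermutationSetoid.Unique-resp-↭ (setoid W) (↭⇒↭ₛ (↭-sym L'↭))
                                                (++⁺ (unique P) (necklace-unique least) disjoint)
    ; sound = [ sound P , necklace-sound se ] ∘ split
    ; rotation-closed = [ old ∘ rotation-closed P , new ∘ necklace-rotate period ] ∘ split
    ; base∈ = old (base∈ P)
    } , L'↭
    where
    L = x ∷ xs
    N = necklace e c
    L' = e' ∷ applyUpTo (λ t → rotate (suc t) e) c ++ rotate 0 e ∷ ys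
    same′ : SameTail (rotate 0 e) e'
    same′ = subst (λ v → SameTail v e') (sym (rotate-zero e)) same
    L'↭ : L' ↭ L ++ N
    L'↭ = ↭-trans (↭-prep e' (↭-trans (shift (rotate 0 e) _ ys) (++-comm N ys))) (++⁺ʳ N e'ys↭L)
    split : ∀ {w} → w ∈ L' → w ∈ L ⊎ w ∈ N
    split = ∈-++⁻ L ∘ ∈-resp-↭ L'↭
    old : ∀ {w} → w ∈ L → w ∈ L'
    old = ∈-resp-↭ (↭-sym L'↭) ∘ ∈-++⁺ˡ
    new : ∀ {w} → w ∈ N → w ∈ L'
    new = ∈-resp-↭ (↭-sym L'↭) ∘ ∈-++⁺ʳ L
    disjoint : Disjoint L N
    disjoint (w∈L , w∈N) = let (t , _ , w≡) = ∈-necklace⁻ {e} {c} w∈N in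
      e∉L (rotate-closed⁻ (_∈ L) (rotation-closed P) t (subst (_∈ L) w≡ w∈L))

  grow : ∀ {L w} → PartialCycle L → S w → w ∉ L →
         Σ (List W) λ L' → PartialCycle L' × unseen L' allWords < unseen L allWords
  grow {L} P sw w∉L with boundary (rotation-closed P) (base∈ P) w∉L sw (connected sw)
  ... | e , e' , se , e∉L , e'∈L , same with leastPeriod e
  ...   | c , least with join-necklace P se e∉L e'∈L same least
  ...     | L' , P' , L'↭ =
    L' , P' , unseen-mono-< (grown ∘ ∈-++⁺ˡ) e∉L (grown (∈-++⁺ʳ L (∈-necklace-self c))) (∈-allVec e)
    where
    grown : L ++ necklace e c ⊆ L'
    grown = ∈-resp-↭ (↭-sym L'↭)

  saturate : ∀ {L} → PartialCycle L → Acc _<_ (unseen L allWords) →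
             Σ (List W) λ L' → PartialCycle L' × (∀ {w} → S w → w ∈ L')
  saturate {L} P (acc smaller) with any? (λ w → S? w ×-dec ¬? (w ∈? L)) allWords
  ... | yes missing = let (_ , _ , sw , w∉L) = find missing
                          (L' , P' , fewer) = grow P sw w∉L
                      in saturate P' (smaller fewer)
  ... | no none = L , P , λ {w} sw →
    decidable-stable (w ∈? L) (λ w∉L → none (lose (∈-allVec w) (sw , w∉L)))

  hasUCycle : HasUCycle (suc m) S
  hasUCycle with saturate (proj₂ initial) (<-wellFounded _)
  ... | [] , P , _ = ⊥-elim (closed P)
  ... | x ∷ xs , P , complete = suc (length xs) , _ , (λ i → lookup (c i) zero) , record
    { windows-in-W = λ i → subst S (sym (window≡ i)) (sound P (∈-lookup i))
    ; windows-distinct = λ i j eq →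
        Unique-lookup-injective (unique P) (trans (sym (window≡ i)) (trans eq (window≡ j)))
    ; covers-W = λ w sw → let w∈ = complete sw in
        index w∈ , trans (window≡ (index w∈)) (sym (lookup-index w∈))
    }
    where
    c : Fin (suc (length xs)) → W
    c = List.lookup (x ∷ xs)
    window≡ : ∀ i → window (suc m) (λ i → lookup (c i) zero) i ≡ c i
    window≡ = window-overlapping c (Closed-lookup-next (closed P))

count-update-< : ∀ {A : Set} {P : A → Set} (P? : Decidable P) {l} (xs : Vec A l) j {y} →
                 P (lookup xs j) → ¬ P y → count P? (xs [ j ]≔ y) < count P? xs
count-update-< P? (x Vec.∷ xs) zero {y} px ¬py rewrite dec-true (P? x) px | dec-false (P? y) ¬py = ≤-refl
count-update-< P? (x Vec.∷ xs) (suc j) px ¬py with does (P? x)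
... | true = s≤s (count-update-< P? xs j px ¬py)
... | false = count-update-< P? xs j px ¬py

almostOnto? : ∀ {k l} (w : Word k l) → Dec (AlmostOnto w)
almostOnto? {k} w = anyᶠ? λ a → ¬? (a ∈? w) ×-dec allᶠ? λ b → ¬? (b ≟ a) →-dec (b ∈? w)
  where open DecVecMembership (_≟_ {k}) using (_∈?_)

module AlmostOntoWords (k : ℕ) where

  m : ℕ
  m = suc (suc k)

  n : ℕ
  n = suc m

  open Words {n} {m}

  Path : W → W → Set
  Path = Star (Move AlmostOnto)

  Misses : Fin n → W → Set
  Misses a w = (∀ p → lookup w p ≢ a) × (∀ b → b ≢ a → ∃ λ p → lookup w p ≡ b)

  Misses⇒AlmostOnto : ∀ {a w} → Misses a w → AlmostOnto w
  Misses⇒AlmostOnto {a} {w} (a∉ , covered) =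
    a , (λ a∈ → a∉ (Anyᵥ.index a∈) (sym (lookup-indexᵥ a∈))) ,
    λ b b≢a → let (p , wp≡b) = covered b b≢a in subst (_∈ᵥ w) wp≡b (∈-lookupᵥ p w)

  AlmostOnto⇒Misses : ∀ {w} → AlmostOnto w → ∃ λ a → Misses a w
  AlmostOnto⇒Misses {w} (a , a∉ , covered) =
    a , (λ p wp≡a → a∉ (subst (_∈ᵥ w) wp≡a (∈-lookupᵥ p w))) ,
    λ b b≢a → let b∈ = covered b b≢a in Anyᵥ.index b∈ , sym (lookup-indexᵥ b∈)

  AlmostOnto-rotate : ∀ {w} → AlmostOnto w → AlmostOnto (rotate 1 w)
  AlmostOnto-rotate {w} (a , a∉ , covered) =
    a , a∉ ∘ ∈-rotate⁻ 1 w , λ b b≢a → ∈-rotate⁺ 1 w (covered b b≢a)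

  move : ∀ {a w} j y → Misses a (w [ j ]≔ y) → Path w (w [ j ]≔ y)
  move j y ms = change j y (Misses⇒AlmostOnto ms) ◅ ε

  replace-sole : ∀ {a c} g j → Misses a g → lookup g j ≡ c → (∀ t → t ≢ j → lookup g t ≢ c) →
                 Misses c (g [ j ]≔ a)
  replace-sole {a} {c} g j (a∉ , covered) gj≡c sole = c∉ , covered′
    where
    c∉ : ∀ p → lookup (g [ j ]≔ a) p ≢ c
    c∉ p with p ≟ j
    ... | yes refl = λ a≡c → a∉ j (trans gj≡c (trans (sym a≡c) (lookup∘update j g a)))
    ... | no p≢j = λ g′p≡c → sole p p≢j (trans (sym (lookup∘update′ p≢j g a)) g′p≡c)
    covered′ : ∀ b → b ≢ c → ∃ λ p → lookup (g [ j ]≔ a) p ≡ b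
    covered′ b b≢c with b ≟ a
    ... | yes refl = j , lookup∘update j g a
    ... | no b≢a with covered b b≢a
    ...   | p , gp≡b with p ≟ j
    ...     | yes refl = contradiction (trans (sym gp≡b) gj≡c) b≢c
    ...     | no p≢j = p , trans (lookup∘update′ p≢j g a) gp≡b

  replace-duplicate : ∀ {a j'} g j y → Misses a g → j' ≢ j → lookup g j' ≡ lookup g j → y ≢ a →
                      Misses a (g [ j ]≔ y)
  replace-duplicate {a} {j'} g j y (a∉ , covered) j'≢j dup y≢a = a∉′ , covered′
    where
    a∉′ : ∀ p → lookup (g [ j ]≔ y) p ≢ a
    a∉′ p with p ≟ j
    ... | yes refl = λ y≡a → y≢a (trans (sym (lookup∘update j g y)) y≡a)
    ... | no p≢j = λ g′p≡a → a∉ p (trans (sym (lookup∘update′ p≢j g y)) g′p≡a)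
    covered′ : ∀ b → b ≢ a → ∃ λ p → lookup (g [ j ]≔ y) p ≡ b
    covered′ b b≢a with covered b b≢a
    ... | p , gp≡b with p ≟ j
    ...   | yes refl = j' , trans (lookup∘update′ j'≢j g y) (trans dup gp≡b)
    ...   | no p≢j = p , trans (lookup∘update′ p≢j g y) gp≡b

  duplicate? : ∀ (g : W) p → Dec (∃ λ t → t ≢ p × lookup g t ≡ lookup g p)
  duplicate? g p = anyᶠ? λ t → ¬? (t ≟ p) ×-dec (lookup g t ≟ lookup g p)

  Swapped : W → W → Fin n → Fin n → Set
  Swapped g g' P K = lookup g' P ≡ lookup g K × lookup g' K ≡ lookup g P ×
                     (∀ t → t ≢ P → t ≢ K → lookup g' t ≡ lookup g t)

  Swapped-sym : ∀ {g g' P K} → Swapped g g' P K → Swapped g g' K P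
  Swapped-sym (g'P , g'K , rest) = g'K , g'P , λ t t≢K t≢P → rest t t≢P t≢K

  SwapPath : ∀ {a} → W → Fin n → Fin n → Set
  SwapPath {a} g P K = Σ W λ g' → Swapped g g' P K × Path g g' × Misses a g'

  -- As the letter at P also occurs at j', P can take the letter at K, and then K the old letter at P.
  swap-via-duplicate : ∀ {a g} P K j' → Misses a g → P ≢ K → j' ≢ P → lookup g j' ≡ lookup g P →
                       SwapPath {a} g P K
  swap-via-duplicate {a} {g} P K j' ms P≢K j'≢P dup =
    g₂ , (g₂P , lookup∘update K g₁ (lookup g P) , unchanged) ,
    move P (lookup g K) ms₁ ◅◅ move K (lookup g P) ms₂ , ms₂
    where
    K≢P : K ≢ P
    K≢P = P≢K ∘ sym
    g₁ = g [ P ]≔ lookup g K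
    g₂ = g₁ [ K ]≔ lookup g P
    ms₁ : Misses a g₁
    ms₁ = replace-duplicate g P (lookup g K) ms j'≢P dup (proj₁ ms K)
    ms₂ : Misses a g₂
    ms₂ = replace-duplicate g₁ K (lookup g P) ms₁ P≢K
            (trans (lookup∘update P g (lookup g K)) (sym (lookup∘update′ K≢P g _))) (proj₁ ms P)
    g₂P : lookup g₂ P ≡ lookup g K
    g₂P = trans (lookup∘update′ P≢K g₁ _) (lookup∘update P g _)
    unchanged : ∀ t → t ≢ P → t ≢ K → lookup g₂ t ≡ lookup g t
    unchanged t t≢P t≢K = trans (lookup∘update′ t≢K g₁ _) (lookup∘update′ t≢P g _)

  -- With both letters occurring once, the missing letter a serves as a temporary third value.
  swap-via-missing : ∀ {a g} P K → Misses a g → P ≢ K → lookup g P ≢ lookup g K →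
                     (∀ t → t ≢ P → lookup g t ≢ lookup g P) →
                     (∀ t → t ≢ K → lookup g t ≢ lookup g K) → SwapPath {a} g P K
  swap-via-missing {a} {g} P K ms P≢K c≢d sole-P sole-K =
    g₃ , (g₃P , lookup∘update K g₂ c , unchanged) ,
    move K a ms₁ ◅◅ move P d ms₂ ◅◅ move K c ms₃ , ms₃
    where
    c = lookup g P
    d = lookup g K
    K≢P : K ≢ P
    K≢P = P≢K ∘ sym
    g₁ = g [ K ]≔ a
    g₂ = g₁ [ P ]≔ d
    g₃ = g₂ [ K ]≔ c
    ms₁ : Misses d g₁
    ms₁ = replace-sole g K ms refl sole-K
    ms₂ : Misses c g₂
    ms₂ = replace-sole g₁ P ms₁ (lookup∘update′ P≢K g a) sole
      where
      sole : ∀ t → t ≢ P → lookup g₁ t ≢ c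
      sole t t≢P with t ≟ K
      ... | yes refl = λ a≡c → proj₁ ms P (trans (sym a≡c) (lookup∘update K g a))
      ... | no t≢K = λ g₁t≡c → sole-P t t≢P (trans (sym (lookup∘update′ t≢K g a)) g₁t≡c)
    ms₃ : Misses a g₃
    ms₃ = replace-sole g₂ K ms₂ (trans (lookup∘update′ K≢P g₁ d) (lookup∘update K g a)) sole
      where
      sole : ∀ t → t ≢ K → lookup g₂ t ≢ a
      sole t t≢K with t ≟ P
      ... | yes refl = λ d≡a → proj₁ ms K (trans (sym (lookup∘update P g₁ d)) d≡a)
      ... | no t≢P = λ g₂t≡a →
        proj₁ ms t (trans (sym (trans (lookup∘update′ t≢P g₁ d) (lookup∘update′ t≢K g a))) g₂t≡a)
    g₃P : lookup g₃ P ≡ d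
    g₃P = trans (lookup∘update′ P≢K g₂ c) (lookup∘update P g₁ d)
    unchanged : ∀ t → t ≢ P → t ≢ K → lookup g₃ t ≡ lookup g t
    unchanged t t≢P t≢K =
      trans (lookup∘update′ t≢K g₂ c) (trans (lookup∘update′ t≢P g₁ d) (lookup∘update′ t≢K g a))

  swap : ∀ {a g} P K → Misses a g → SwapPath {a} g P K
  swap {a} {g} P K ms with lookup g P ≟ lookup g K
  ... | yes same = g , (same , sym same , λ _ _ _ → refl) , ε , ms
  ... | no c≢d with duplicate? g P
  ...   | yes (j' , j'≢P , dup) = swap-via-duplicate P K j' ms (c≢d ∘ cong (lookup g)) j'≢P dup
  ...   | no sole-P with duplicate? g K
  ...     | yes (j' , j'≢K , dup) =
            let (g' , swapped , path , ms') =
                  swap-via-duplicate K P j' ms (c≢d ∘ cong (lookup g) ∘ sym) j'≢K dup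
            in g' , Swapped-sym {g} {g'} swapped , path , ms'
  ...     | no sole-K = swap-via-missing P K ms (c≢d ∘ cong (lookup g)) c≢d
                          (λ t t≢P dup → sole-P (t , t≢P , dup)) (λ t t≢K dup → sole-K (t , t≢K , dup))

  last : Fin n
  last = fromℕ m

  ≢last⇒m≢toℕ : ∀ {b} → b ≢ last → m ≢ toℕ b
  ≢last⇒m≢toℕ b≢last m≡b = b≢last (toℕ-injective (trans (sym m≡b) (sym (toℕ-fromℕ m))))

  base : W
  base = zero Vec.∷ tabulate inject₁

  lookup-base : ∀ q → lookup base (suc q) ≡ inject₁ q
  lookup-base = lookup∘tabulate inject₁

  Misses-base : Misses last base
  Misses-base = last∉ , covered
    where
    last∉ : ∀ p → lookup base p ≢ last
    last∉ zero ()
    last∉ (suc q) eq = fromℕ≢inject₁ (sym (trans (sym (lookup-base q)) eq))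
    covered : ∀ b → b ≢ last → ∃ λ p → lookup base p ≡ b
    covered b b≢last = suc (lower₁ b m≢b) , trans (lookup-base _) (inject₁-lower₁ b m≢b)
      where m≢b = ≢last⇒m≢toℕ b≢last

  avoid : ∀ (a b : Fin n) → ∃ λ y → y ≢ a × y ≢ b
  avoid a b with zero ≟ a | zero ≟ b
  ... | no 0≢a | no 0≢b = zero , 0≢a , 0≢b
  ... | yes refl | _ with suc zero ≟ b
  ...   | no 1≢b = suc zero , (λ ()) , 1≢b
  ...   | yes refl = suc (suc zero) , (λ ()) , (λ ())
  avoid a b | no 0≢a | yes refl with suc zero ≟ a
  ...   | no 1≢a = suc zero , 1≢a , (λ ())
  ...   | yes refl = suc (suc zero) , (λ ()) , (λ ())

  -- While last occurs twice, replace one occurrence by a third letter; once it is unique, replace it by a.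
  toMissingLast : ∀ {a g} → Misses a g → Acc _<_ (count (_≟ last) g) →
                  Σ W λ g' → Path g g' × Misses last g'
  toMissingLast {a} {g} ms (acc smaller) with a ≟ last
  ... | yes refl = g , ε , ms
  ... | no a≢last with proj₂ ms last (a≢last ∘ sym)
  ...   | j , gj≡last with duplicate? g j
  ...     | no sole = g [ j ]≔ a , move j a ms′ , ms′
    where
    ms′ = replace-sole g j ms gj≡last (λ t t≢j gt≡last → sole (t , t≢j , trans gt≡last (sym gj≡last)))
  ...     | yes (j' , j'≢j , dup) =
    let (y , y≢a , y≢last) = avoid a last
        ms₁ = replace-duplicate g j y ms j'≢j dup y≢a
        (g' , path , ms′) = toMissingLast ms₁ (smaller (count-update-< (_≟ last) g j gj≡last y≢last))
    in g' , move j y ms₁ ◅◅ path , ms′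

  Sorted : ℕ → W → Set
  Sorted i g = ∀ (q : Fin m) → i ≤ toℕ q → lookup g (suc q) ≡ inject₁ q

  sort-step : ∀ {i g} → i < m → Misses last g → Sorted (suc i) g →
              Σ W λ g' → Path g g' × Misses last g' × Sorted i g'
  sort-step {i} {g} i<m ms sorted =
    let (K , gK≡Q) = proj₂ ms (inject₁ Q) (fromℕ≢inject₁ ∘ sym)
        (g' , (g'Q , _ , unchanged) , path , ms') = swap (suc Q) K ms
    in g' , path , ms' , sorted-after-swap {g'} K gK≡Q g'Q unchanged
    where
    Q = fromℕ< i<m
    q≢Q : ∀ q → i < toℕ q → q ≢ Q
    q≢Q q i<q q≡Q = <⇒≢ i<q (sym (trans (cong toℕ q≡Q) (toℕ-fromℕ< i<m)))
    sorted-after-swap : ∀ {g'} K → lookup g K ≡ inject₁ Q → lookup g' (suc Q) ≡ lookup g K →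
                        (∀ t → t ≢ suc Q → t ≢ K → lookup g' t ≡ lookup g t) → Sorted i g'
    sorted-after-swap {g'} K gK≡Q g'Q unchanged q i≤q with m≤n⇒m<n∨m≡n i≤q
    ... | inj₁ i<q = trans (unchanged (suc q) (q≢Q q i<q ∘ suc-injective) K≢sq) (sorted q i<q)
      where
      K≢sq : suc q ≢ K
      K≢sq refl = q≢Q q i<q (inject₁-injective (trans (sym (sorted q i<q)) gK≡Q))
    ... | inj₂ i≡q = subst (λ q → lookup g' (suc q) ≡ inject₁ q) Q≡q (trans g'Q gK≡Q)
      where
      Q≡q : Q ≡ q
      Q≡q = toℕ-injective (trans (toℕ-fromℕ< i<m) i≡q)

  sort : ∀ i {g} → i ≤ m → Misses last g → Sorted i g →
         Σ W λ g' → Path g g' × Misses last g' × Sorted 0 g'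
  sort zero _ ms sorted = _ , ε , ms , sorted
  sort (suc i) i<m ms sorted =
    let (g₁ , path₁ , ms₁ , sorted₁) = sort-step i<m ms sorted
        (g₂ , path₂ , ms₂ , sorted₂) = sort i (<⇒≤ i<m) ms₁ sorted₁
    in g₂ , path₁ ◅◅ path₂ , ms₂ , sorted₂

  -- Position 0 holds some v ≠ last, which also occurs at the sorted position 1 + v.
  finish : ∀ {g} → Misses last g → Sorted 0 g → Path g base
  finish {g} ms sorted = subst (Path g) g₀≡base (move zero zero ms₀)
    where
    v = lookup g zero
    m≢v : m ≢ toℕ v
    m≢v = ≢last⇒m≢toℕ (proj₁ ms zero)
    ms₀ : Misses last (g [ zero ]≔ zero)
    ms₀ = replace-duplicate {j' = suc (lower₁ v m≢v)} g zero zero ms (λ ())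
                            (trans (sorted (lower₁ v m≢v) z≤n) (inject₁-lower₁ v m≢v)) (λ ())
    g₀≡base : g [ zero ]≔ zero ≡ base
    g₀≡base = Vec-ext λ where
      zero → lookup∘update zero g zero
      (suc q) → trans (lookup∘update′ (λ ()) g zero) (trans (sorted q z≤n) (sym (lookup-base q)))

  connected : ∀ {w} → AlmostOnto w → Path w base
  connected ao =
    let (a , ms) = AlmostOnto⇒Misses ao
        (g₁ , path₁ , ms₁) = toMissingLast ms (<-wellFounded _)
        (g₂ , path₂ , ms₂ , sorted) = sort m ≤-refl ms₁ λ q m≤q → contradiction (toℕ<n q) (≤⇒≯ m≤q)
    in path₁ ◅◅ path₂ ◅◅ finish ms₂ sorted

  hasUCycle : HasUCycle n AlmostOnto
  hasUCycle = CycleJoining.hasUCycle AlmostOnto almostOnto? AlmostOnto-rotate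
                                     base (Misses⇒AlmostOnto Misses-base) connected

theorem5 : ∀ (n : ℕ) → n ≥ 3 → HasUCycle {Fin n} n (AlmostOnto {n} {n})
theorem5 _ (s≤s (s≤s (s≤s {n = k} _))) = AlmostOntoWords.hasUCycle k
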